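{- Let $G$ be a finite abelian group of order $n\ge 2$ and exponent $q$, and let $l$ be the order of its subgroup $L$ of elements of order at most $2$. Then for every integer $h$ with $$(n+l)/2-1 \le h \le n-2$$ we have $C_h(G)=Z_h(G)=h+1$, with the following two exceptions: (i) if $h=n-3$ and $q=3$, then $C_h(G)=h+1$ and $Z_h(G)=h$; (ii) if $h=n-2$, $l=2$, and $q\equiv 2 \pmod 4$, then $C_h(G)=h+1$ and $Z_h(G)=h$.
   Context: $G$ is written additively. $L=\{g\in G: 2g=0\}$ is the subgroup consisting of $0$ and all involutions. For a subset $A\subseteq G$ and positive integer $h$, the $h$-fold restricted sumset $h\hat{\;}A$ is the set of all elements of $G$ that can be written as a sum of $h$ pairwise distinct elements of $A$. Define $C_h(G)=\max\{|A| : A\subseteq G,\ h\hat{\;}A\neq G\}$ and $Z_h(G)=\max\{|A| : A\subseteq G,\ 0\notin h\hat{\;}A\}$. -}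

module Defs where

open import Data.Nat using (ℕ; zero; suc; _+_; _*_; _≤_; _<_)
open import Data.Fin using (Fin; _≟_)
open import Data.Fin.Subset using (Subset; _∈_; ∣_∣)
open import Data.Vec using (tabulate)
open import Data.List using (List; []; _∷_; length)
open import Data.List.Relation.Unary.All using (All)
open import Data.List.Relation.Unary.Unique.Propositional using (Unique)
open import Data.Product using (Σ; _×_; ∃-syntax)
open import Relation.Nullary using (¬_; does)
open import Relation.Binary.PropositionalEquality using (_≡_)

-- A finite abelian group of order n, presented (up to isomorphism) as an
-- abelian group structure on the carrier Fin n, with propositional equality.
record FinAbGroup (n : ℕ) : Set where
  infixl 6 _⊕_
  field
    _⊕_     : Fin n → Fin n → Fin n
    𝟘       : Fin n
    ⊖_      : Fin n → Fin n
    assoc   : ∀ x y z → (x ⊕ y) ⊕ z ≡ x ⊕ (y ⊕ z)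
    comm    : ∀ x y → x ⊕ y ≡ y ⊕ x
    identityˡ : ∀ x → 𝟘 ⊕ x ≡ x
    inverseˡ  : ∀ x → (⊖ x) ⊕ x ≡ 𝟘

  Σl : List (Fin n) → Fin n
  Σl []       = 𝟘
  Σl (x ∷ xs) = x ⊕ Σl xs

  _·_ : ℕ → Fin n → Fin n
  zero  · g = 𝟘
  suc m · g = g ⊕ (m · g)

  IsExponent : ℕ → Set
  IsExponent q = (0 < q) × (∀ g → q · g ≡ 𝟘)
                 × (∀ m → 0 < m → (∀ g → m · g ≡ 𝟘) → q ≤ m)

  L : Subset n
  L = tabulate (λ g → does ((g ⊕ g) ≟ 𝟘))

  l : ℕ
  l = ∣ L ∣

  _∈RestrSum_,_ : Fin n → ℕ → Subset n → Set
  g ∈RestrSum h , A = ∃[ xs ] (length xs ≡ h × Unique xs × All (_∈ A) xs × Σl xs ≡ g)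

  RestrSumNotAll : ℕ → Subset n → Set
  RestrSumNotAll h A = ¬ (∀ g → g ∈RestrSum h , A)

  ZeroNotInRestrSum : ℕ → Subset n → Set
  ZeroNotInRestrSum h A = ¬ (𝟘 ∈RestrSum h , A)

IsMaxSize : ∀ {n} → (Subset n → Set) → ℕ → Set
IsMaxSize {n} P k = (Σ (Subset n) λ A → ∣ A ∣ ≡ k × P A) × (∀ A → P A → ∣ A ∣ ≤ k)

module _ {n : ℕ} (G : FinAbGroup n) where
  open FinAbGroup G
  C≡ : ℕ → ℕ → Set
  C≡ h k = IsMaxSize (RestrSumNotAll h) k
  Z≡ : ℕ → ℕ → Set
  Z≡ h k = IsMaxSize (ZeroNotInRestrSum h) k

{-# OPTIONS --safe #-}
module Submission where

-- Take h + 2 elements ys of a set A and put t = Σ ys − g. Some a ∈ ys has t − a ∈ ys and 2a ≠ t,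
-- since only (n − h − 2) + l < h + 2 elements of ys violate this; removing a and t − a leaves h
-- elements summing to g. So no set of size h + 2 has h^A ≠ G, while an (h + 1)-set A misses ΣA − c
-- for every c ∉ A.
--
-- The restricted h-sums of an (h + 1)-set A are the ΣA − a, so 0 ∉ h^A iff ΣA ∉ A, i.e. iff its
-- complement B, of size k = n − h − 1 with 2k + l ≤ n, contains σ(G) − ΣB. Such B are built directly
-- for k = 3, 4 and grow from k to k + 2 by a pair {t, −t} with t ∉ L. For k = 1 one needs b with
-- 2b = σ(G), for k = 2 some x with 3x ≠ σ(G). Pairing off L by a translation shows σ(G) = 0 unless
-- L = {0, σ(G)}, and the exponent then decides exactly when these fail: the two exceptional cases,
-- where Z_h(G) = h is attained by any h-set with nonzero sum.

open import Defs
open import Algebra.Bundles using (AbelianGroup)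
open import Algebra.Structures using (IsAbelianGroup)
import Algebra.Properties.AbelianGroup as AbelianGroupProperties
import Algebra.Properties.CommutativeSemigroup as CommutativeSemigroupProperties
import Algebra.Properties.Group as GroupProperties
open import Data.Fin using (Fin; zero; suc)
open import Data.Fin.Properties using (_≟_; any?)
import Data.Fin.Properties as Fin
open import Data.Fin.Subset using (Subset; ∣_∣; inside; outside) renaming (_∈_ to _∈ₛ_)
open import Data.List using (List; []; _∷_; length; map; filter; allFin; _++_; foldr)
open import Data.List.Properties using (length-map; length-++; length-tabulate; filter-notAll)
open import Data.List.Membership.Propositional using (_∈_; _∉_; find)
open import Data.List.Membership.Propositional.Properties
  using (∈-map⁺; ∈-map⁻; ∈-++⁺ˡ; ∈-++⁺ʳ; ∈-filter⁺; ∈-filter⁻; ∈-allFin)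
open import Data.List.Membership.Propositional.Properties.WithK using (unique∧set⇒bag)
open import Data.List.Relation.Binary.BagAndSetEquality using (∼bag⇒↭)
open import Data.List.Relation.Binary.Permutation.Propositional using (_↭_; ↭⇒↭ₛ)
open import Data.List.Relation.Binary.Permutation.Propositional.Properties using (↭-length)
open import Data.List.Relation.Binary.Permutation.Setoid.Properties using (foldr-commMonoid)
open import Data.List.Relation.Binary.Subset.Propositional using (_⊆_)
open import Data.List.Relation.Binary.Subset.Propositional.Properties using (∷⁺ʳ; ∈-∷⁺ʳ)
open import Data.List.Relation.Unary.All as All using (All; []; _∷_; all?)
open import Data.List.Relation.Unary.All.Properties using () renaming (map⁺ to All-map⁺)
open import Data.List.Relation.Unary.All.Properties.Core using (¬All⇒Any¬; ¬Any⇒All¬)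
open import Data.List.Relation.Unary.AllPairs using ([]; _∷_)
open import Data.List.Relation.Unary.Any as Any using (here; there)
open import Data.List.Relation.Unary.Unique.Propositional using (Unique)
import Data.List.Relation.Unary.Unique.Propositional.Properties as Unique
open import Data.Nat using (ℕ; zero; suc; _+_; _*_; _∸_; _≤_; _<_; _%_; _/_; z≤n; s≤s; NonZero)
open import Data.Nat.DivMod using (m≡m%n+[m/n]*n; m%n<n)
open import Data.Nat.Properties
  using (≤-refl; ≤-trans; ≤-reflexive; ≤-antisym; <⇒≤; <⇒≱; ≰⇒>; <-≤-trans; ≤-<-trans; _≤?_;
         m≤n⇒m<n∨m≡n; ≤-pred; suc-injective; n≢0⇒n>0; m<n⇒0<n∸m;
         +-comm; +-assoc; +-suc; +-cancelˡ-≡; +-cancelˡ-≤; +-cancelˡ-<; +-monoʳ-≤; +-monoˡ-≤; +-monoʳ-<;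
         +-mono-≤; +-mono-<; m≤m+n; m<m+n; m<n+m; *-suc; *-cancelˡ-≡; m+[n∸m]≡n; module ≤-Reasoning)
open import Data.Nat.Tactic.RingSolver using (solve-∀)
open import Data.Product using (∃; ∃-syntax; ∃₂; _×_; _,_; proj₁; proj₂)
open import Data.Sum using (_⊎_; inj₁; inj₂; [_,_]′)
open import Data.Vec as Vec using (tabulate; []; _∷_)
open import Data.Vec.Properties using (lookup∘tabulate; []=⇒lookup; lookup⇒[]=)
open import Function using (_∘_; id; mk⇔)
open import Level using (0ℓ)
open import Relation.Binary.Definitions using (DecidableEquality)
open import Relation.Binary.PropositionalEquality
  using (_≡_; _≢_; refl; sym; trans; cong; cong₂; subst; subst₂; isEquivalence; setoid; module ≡-Reasoning)
open import Relation.Nullary using (¬_; Dec; yes; no; does; ¬?)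
open import Relation.Nullary.Decidable using (dec-true; decidable-stable)
open import Relation.Nullary.Negation using (contradiction)
open import Relation.Unary using (Pred; Decidable)

module _ {A : Set} where

  ↭-of-⊆⊇ : ∀ {xs ys : List A} → Unique xs → Unique ys → xs ⊆ ys → ys ⊆ xs → xs ↭ ys
  ↭-of-⊆⊇ u v xs⊆ys ys⊆xs = ∼bag⇒↭ (unique∧set⇒bag u v (mk⇔ xs⊆ys ys⊆xs))

  ∃-sublist : ∀ {xs : List A} m → Unique xs → m ≤ length xs →
              ∃[ ys ] (Unique ys × length ys ≡ m × ys ⊆ xs)
  ∃-sublist zero _ _ = [] , [] , refl , λ ()
  ∃-sublist {x ∷ xs} (suc m) (x∉xs ∷ u) (s≤s m≤) with ∃-sublist m u m≤
  ... | ys , v , refl , ys⊆xs =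
    x ∷ ys , All.tabulate (λ p → All.lookup x∉xs (ys⊆xs p)) ∷ v , refl , ∷⁺ʳ x ys⊆xs

module DistinctLists {A : Set} (_≟_ : DecidableEquality A) where

  open import Data.List.Membership.DecPropositional _≟_ public using (_∈?_)

  remove : A → List A → List A
  remove x = filter (λ y → ¬? (x ≟ y))

  ∈-remove⁺ : ∀ {x y ys} → y ∈ ys → x ≢ y → y ∈ remove x ys
  ∈-remove⁺ {x} = ∈-filter⁺ (λ y → ¬? (x ≟ y))

  ∈-remove⁻ : ∀ {x y ys} → y ∈ remove x ys → y ∈ ys × x ≢ y
  ∈-remove⁻ {x} {ys = ys} = ∈-filter⁻ (λ y → ¬? (x ≟ y)) {xs = ys}

  remove-unique : ∀ {x ys} → Unique ys → Unique (remove x ys)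
  remove-unique {x} = Unique.filter⁺ (λ y → ¬? (x ≟ y))

  length-remove< : ∀ {x ys} → x ∈ ys → length (remove x ys) < length ys
  length-remove< {x} {ys} x∈ys = filter-notAll (λ y → ¬? (x ≟ y)) ys (Any.map (λ x≡y x≢y → x≢y x≡y) x∈ys)

  remove-↭ : ∀ {x ys} → Unique ys → x ∈ ys → x ∷ remove x ys ↭ ys
  remove-↭ {x} {ys} u x∈ys =
    ↭-of-⊆⊇ (All.tabulate (λ p → proj₂ (∈-remove⁻ {ys = ys} p)) ∷ remove-unique u) u ⊆ys ys⊆
    where
      ⊆ys : x ∷ remove x ys ⊆ ys
      ⊆ys (here refl) = x∈ys
      ⊆ys (there p)   = proj₁ (∈-remove⁻ p)
      ys⊆ : ys ⊆ x ∷ remove x ys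
      ys⊆ {y} y∈ys with x ≟ y
      ... | yes refl = here refl
      ... | no x≢y   = there (∈-remove⁺ y∈ys x≢y)

  length-remove : ∀ {x ys} → Unique ys → x ∈ ys → length ys ≡ suc (length (remove x ys))
  length-remove u x∈ys = sym (↭-length (remove-↭ u x∈ys))

  length-mono-⊆ : ∀ {xs ys} → Unique xs → xs ⊆ ys → length xs ≤ length ys
  length-mono-⊆ {[]}     _            _     = z≤n
  length-mono-⊆ {x ∷ xs} (x∉xs ∷ u) xs⊆ys =
    ≤-trans (s≤s (length-mono-⊆ u (λ p → ∈-remove⁺ (xs⊆ys (there p)) (All.lookup x∉xs p))))
            (length-remove< (xs⊆ys (here refl)))

  find-∉ : ∀ {xs ys} → Unique xs → length ys < length xs → ∃[ x ] (x ∈ xs × x ∉ ys)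
  find-∉ {xs} {ys} u ys<xs with all? (_∈? ys) xs
  ... | yes xs⊆ys = contradiction (length-mono-⊆ u (All.lookup xs⊆ys)) (<⇒≱ ys<xs)
  ... | no  xs⊈ys = find (¬All⇒Any¬ (_∈? ys) xs xs⊈ys)

  ↭-of-⊆ : ∀ {xs ys} → Unique xs → Unique ys → xs ⊆ ys → length ys ≤ length xs → xs ↭ ys
  ↭-of-⊆ {xs} {ys} u v xs⊆ys ys≤xs = ↭-of-⊆⊇ u v xs⊆ys ys⊆xs
    where
      ys⊆xs : ys ⊆ xs
      ys⊆xs {z} z∈ys with z ∈? xs
      ... | yes z∈xs = z∈xs
      ... | no  z∉xs = contradiction (length-mono-⊆ (¬Any⇒All¬ xs z∉xs ∷ u) (∈-∷⁺ʳ z∈ys xs⊆ys))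
                                     (<⇒≱ (s≤s ys≤xs))

open module DistinctFinLists {n} = DistinctLists (_≟_ {n})

module _ {n : ℕ} where

  length-allFin : length (allFin n) ≡ n
  length-allFin = length-tabulate id

  complement : List (Fin n) → List (Fin n)
  complement ys = filter (λ x → ¬? (x ∈? ys)) (allFin n)

  complement-unique : ∀ ys → Unique (complement ys)
  complement-unique ys = Unique.filter⁺ (λ x → ¬? (x ∈? ys)) (Unique.allFin⁺ n)

  ∈-complement⁺ : ∀ {ys z} → z ∉ ys → z ∈ complement ys
  ∈-complement⁺ {ys} = ∈-filter⁺ (λ x → ¬? (x ∈? ys)) (∈-allFin _)

  ∈-complement⁻ : ∀ {ys z} → z ∈ complement ys → z ∉ ys
  ∈-complement⁻ {ys} = proj₂ ∘ ∈-filter⁻ (λ x → ¬? (x ∈? ys)) {xs = allFin n}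

  ++-complement-↭ : ∀ {ys} → Unique ys → ys ++ complement ys ↭ allFin n
  ++-complement-↭ {ys} u =
    ↭-of-⊆⊇ (Unique.++⁺ u (complement-unique ys) (λ (p , q) → ∈-complement⁻ q p))
             (Unique.allFin⁺ n) (λ _ → ∈-allFin _) covered
    where
      covered : allFin n ⊆ ys ++ complement ys
      covered {z} _ with z ∈? ys
      ... | yes z∈ys = ∈-++⁺ˡ z∈ys
      ... | no  z∉ys = ∈-++⁺ʳ ys (∈-complement⁺ z∉ys)

  length-++-complement : ∀ {ys} → Unique ys → length ys + length (complement ys) ≡ n
  length-++-complement {ys} u = begin
    length ys + length (complement ys) ≡⟨ length-++ ys ⟨
    length (ys ++ complement ys)       ≡⟨ ↭-length (++-complement-↭ u) ⟩
    length (allFin n)                  ≡⟨ length-allFin ⟩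
    n                                  ∎
    where open ≡-Reasoning

  length-complement : ∀ {ys k} → Unique ys → length ys + k ≡ n → length (complement ys) ≡ k
  length-complement {ys} u ys+k≡n = +-cancelˡ-≡ (length ys) _ _ (trans (length-++-complement u) (sym ys+k≡n))

elements : ∀ {m} → Subset m → List (Fin m)
elements []            = []
elements (inside ∷ p)  = zero ∷ map suc (elements p)
elements (outside ∷ p) = map suc (elements p)

length-elements : ∀ {m} (p : Subset m) → length (elements p) ≡ ∣ p ∣
length-elements []            = refl
length-elements (inside ∷ p)  = cong suc (trans (length-map suc (elements p)) (length-elements p))
length-elements (outside ∷ p) = trans (length-map suc (elements p)) (length-elements p)

∈-elements⁺ : ∀ {m} {p : Subset m} {x} → x ∈ₛ p → x ∈ elements p
∈-elements⁺ {p = inside ∷ p}  Vec.here      = here refl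
∈-elements⁺ {p = inside ∷ p}  (Vec.there q) = there (∈-map⁺ suc (∈-elements⁺ q))
∈-elements⁺ {p = outside ∷ p} (Vec.there q) = ∈-map⁺ suc (∈-elements⁺ q)

∈-elements⁻ : ∀ {m} {p : Subset m} {x} → x ∈ elements p → x ∈ₛ p
∈-elements⁻ {p = inside ∷ p} (here refl) = Vec.here
∈-elements⁻ {p = inside ∷ p} (there q) with ∈-map⁻ suc q
... | _ , r , refl = Vec.there (∈-elements⁻ r)
∈-elements⁻ {p = outside ∷ p} q with ∈-map⁻ suc q
... | _ , r , refl = Vec.there (∈-elements⁻ r)

elements-unique : ∀ {m} (p : Subset m) → Unique (elements p)
elements-unique []            = []
elements-unique (inside ∷ p)  =
  All-map⁺ (All.universal (λ _ ()) (elements p)) ∷ Unique.map⁺ Fin.suc-injective (elements-unique p)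
elements-unique (outside ∷ p) = Unique.map⁺ Fin.suc-injective (elements-unique p)

⊆-elements : ∀ {m} {p : Subset m} {xs} → All (_∈ₛ p) xs → xs ⊆ elements p
⊆-elements xs∈p x∈xs = ∈-elements⁺ (All.lookup xs∈p x∈xs)

All-∈ₛ : ∀ {m} {p : Subset m} {xs} → xs ⊆ elements p → All (_∈ₛ p) xs
All-∈ₛ xs⊆p = All.tabulate (λ x∈xs → ∈-elements⁻ (xs⊆p x∈xs))

module _ {m} {P : Pred (Fin m) 0ℓ} (P? : Decidable P) where

  ∈-tabulate⁺ : ∀ {x} → P x → x ∈ₛ tabulate (does ∘ P?)
  ∈-tabulate⁺ {x} px = lookup⇒[]= x _ (trans (lookup∘tabulate (does ∘ P?) x) (dec-true (P? x) px))

  ∈-tabulate⁻ : ∀ {x} → x ∈ₛ tabulate (does ∘ P?) → P x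
  ∈-tabulate⁻ {x} x∈ with P? x | trans (sym (lookup∘tabulate (does ∘ P?) x)) ([]=⇒lookup x∈)
  ... | yes px | _  = px
  ... | no  _  | ()

module _ {m : ℕ} where

  fromList : List (Fin m) → Subset m
  fromList xs = tabulate (does ∘ (_∈? xs))

  elements-fromList-↭ : ∀ {xs} → Unique xs → elements (fromList xs) ↭ xs
  elements-fromList-↭ {xs} u =
    ↭-of-⊆⊇ (elements-unique (fromList xs)) u
            (λ p → ∈-tabulate⁻ (_∈? xs) (∈-elements⁻ {p = fromList xs} p))
            (λ p → ∈-elements⁺ {p = fromList xs} (∈-tabulate⁺ (_∈? xs) p))

  ∣fromList∣ : ∀ {xs} → Unique xs → ∣ fromList xs ∣ ≡ length xs
  ∣fromList∣ {xs} u = trans (sym (length-elements (fromList xs))) (↭-length (elements-fromList-↭ u))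

Fin-two-distinct : ∀ {m} → 2 ≤ m → ∃₂ λ (x y : Fin m) → x ≢ y
Fin-two-distinct (s≤s (s≤s _)) = zero , suc zero , λ ()

n+l≤2h+2⇒l+[k+k]≤n : ∀ {h k l n} → suc h + k ≡ n → n + l ≤ 2 * h + 2 → l + (k + k) ≤ n
n+l≤2h+2⇒l+[k+k]≤n {h} {k} {l} {n} n≡ n+l≤ = begin
  l + (k + k)   ≡⟨ rearrange l k ⟩
  (k + l) + k   ≤⟨ +-monoˡ-≤ k k+l≤ ⟩
  (h + 1) + k   ≡⟨ cong (_+ k) (+-comm h 1) ⟩
  suc h + k     ≡⟨ n≡ ⟩
  n             ∎
  where
    open ≤-Reasoning
    rearrange : ∀ l k → l + (k + k) ≡ (k + l) + k
    rearrange = solve-∀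
    twice : ∀ h → 2 * h + 2 ≡ suc h + (h + 1)
    twice = solve-∀
    k+l≤ : k + l ≤ h + 1
    k+l≤ = +-cancelˡ-≤ (suc h) _ _ (begin
      suc h + (k + l)   ≡⟨ +-assoc (suc h) k l ⟨
      suc h + k + l     ≡⟨ cong (_+ l) n≡ ⟩
      n + l             ≤⟨ n+l≤ ⟩
      2 * h + 2         ≡⟨ twice h ⟩
      suc h + (h + 1)   ∎)

≤2h+2⇒<[2+h]+[2+h] : ∀ {x h} → x ≤ 2 * h + 2 → x < (2 + h) + (2 + h)
≤2h+2⇒<[2+h]+[2+h] {x} {h} x≤ =
  ≤-<-trans x≤ (subst (2 * h + 2 <_) (sym (eq h)) (m<n+m (2 * h + 2) {2} (s≤s z≤n)))
  where
    eq : ∀ h → (2 + h) + (2 + h) ≡ 2 + (2 * h + 2)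
    eq = solve-∀

m%2-cases : ∀ m → m % 2 ≡ 0 ⊎ m % 2 ≡ 1
m%2-cases m with m % 2 | m%n<n m 2
... | 0 | _ = inj₁ refl
... | 1 | _ = inj₂ refl
... | suc (suc _) | s≤s (s≤s ())

m%4-cases : ∀ m → m % 4 ≡ 0 ⊎ m % 4 ≡ 1 ⊎ m % 4 ≡ 2 ⊎ m % 4 ≡ 3
m%4-cases m with m % 4 | m%n<n m 4
... | 0 | _ = inj₁ refl
... | 1 | _ = inj₂ (inj₁ refl)
... | 2 | _ = inj₂ (inj₂ (inj₁ refl))
... | 3 | _ = inj₂ (inj₂ (inj₂ refl))
... | suc (suc (suc (suc _))) | s≤s (s≤s (s≤s (s≤s ())))

≤3∧≢3⇒≡1⊎≡2 : ∀ {m} → 0 < m → m ≤ 3 → m ≢ 3 → m ≡ 1 ⊎ m ≡ 2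
≤3∧≢3⇒≡1⊎≡2 {1} _ _ _ = inj₁ refl
≤3∧≢3⇒≡1⊎≡2 {2} _ _ _ = inj₂ refl
≤3∧≢3⇒≡1⊎≡2 {3} _ _ m≢3 = contradiction refl m≢3
≤3∧≢3⇒≡1⊎≡2 {suc (suc (suc (suc _)))} _ (s≤s (s≤s (s≤s ()))) _

n+l≤2h+2⇒1≤h : ∀ {h n l} → h + 2 ≤ n → 1 ≤ l → n + l ≤ 2 * h + 2 → 1 ≤ h
n+l≤2h+2⇒1≤h {zero}  2≤n 1≤l n+l≤2 = contradiction (≤-trans (+-mono-≤ 2≤n 1≤l) n+l≤2) λ { (s≤s (s≤s ())) }
n+l≤2h+2⇒1≤h {suc h} _   _   _     = s≤s z≤n

module FinAbGroupProperties {n : ℕ} (G : FinAbGroup n) where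

  open FinAbGroup G

  isAbelianGroup : IsAbelianGroup _≡_ _⊕_ 𝟘 ⊖_
  isAbelianGroup = record
    { isGroup = record
      { isMonoid = record
        { isSemigroup = record
          { isMagma = record { isEquivalence = isEquivalence ; ∙-cong = cong₂ _⊕_ }
          ; assoc   = assoc
          }
        ; identity = identityˡ , λ x → trans (comm x 𝟘) (identityˡ x)
        }
      ; inverse = inverseˡ , λ x → trans (comm x (⊖ x)) (inverseˡ x)
      ; ⁻¹-cong = cong ⊖_
      }
    ; comm = comm
    }

  abelianGroup : AbelianGroup 0ℓ 0ℓ
  abelianGroup = record { isAbelianGroup = isAbelianGroup }

  open AbelianGroup abelianGroup using (identityʳ; inverseʳ; isCommutativeMonoid; group; commutativeSemigroup)
  open GroupProperties group
    using (ε⁻¹≈ε; ⁻¹-involutive; ⁻¹-injective; ∙-cancelˡ; ∙-cancelʳ; identityʳ-unique; x∙y⁻¹≈ε⇒x≈y;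
           //-rightDividesˡ; //-rightDividesʳ; \\-leftDividesˡ)
  open AbelianGroupProperties abelianGroup using (⁻¹-∙-comm; ⁻¹-anti-homo‿-; xyx⁻¹≈y)
  open CommutativeSemigroupProperties commutativeSemigroup using (interchange; x∙yz≈y∙xz; xy∙z≈xz∙y)

  x⊕[y⊖x]≡y : ∀ x y → x ⊕ (y ⊕ ⊖ x) ≡ y
  x⊕[y⊖x]≡y x y = trans (comm x _) (//-rightDividesˡ x y)

  x⊖[x⊖y]≡y : ∀ x y → x ⊕ ⊖ (x ⊕ ⊖ y) ≡ y
  x⊖[x⊖y]≡y x y = trans (cong (x ⊕_) (⁻¹-anti-homo‿- x y)) (x⊕[y⊖x]≡y x y)

  ≡-⊖ : ∀ {x y z} → x ⊕ y ≡ z → y ≡ z ⊕ ⊖ x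
  ≡-⊖ refl = sym (xyx⁻¹≈y _ _)

  Σl-foldr : ∀ xs → Σl xs ≡ foldr _⊕_ 𝟘 xs
  Σl-foldr []       = refl
  Σl-foldr (x ∷ xs) = cong (x ⊕_) (Σl-foldr xs)

  Σl-↭ : ∀ {xs ys} → xs ↭ ys → Σl xs ≡ Σl ys
  Σl-↭ {xs} {ys} xs↭ys = begin
    Σl xs          ≡⟨ Σl-foldr xs ⟩
    foldr _⊕_ 𝟘 xs ≡⟨ foldr-commMonoid (setoid (Fin n)) isCommutativeMonoid (↭⇒↭ₛ xs↭ys) ⟩
    foldr _⊕_ 𝟘 ys ≡⟨ Σl-foldr ys ⟨
    Σl ys          ∎
    where open ≡-Reasoning

  Σl-++ : ∀ xs ys → Σl (xs ++ ys) ≡ Σl xs ⊕ Σl ys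
  Σl-++ []       ys = sym (identityˡ _)
  Σl-++ (x ∷ xs) ys = trans (cong (x ⊕_) (Σl-++ xs ys)) (sym (assoc x _ _))

  Σl-remove : ∀ {x ys} → Unique ys → x ∈ ys → Σl ys ≡ x ⊕ Σl (remove x ys)
  Σl-remove u x∈ys = sym (Σl-↭ (remove-↭ u x∈ys))

  ΣG : Fin n
  ΣG = Σl (allFin n)

  Σl-complement : ∀ {ys} → Unique ys → Σl ys ⊕ Σl (complement ys) ≡ ΣG
  Σl-complement {ys} u = trans (sym (Σl-++ ys _)) (Σl-↭ (++-complement-↭ u))

  ∈L⁺ : ∀ {x} → x ⊕ x ≡ 𝟘 → x ∈ elements L
  ∈L⁺ x⊕x≡𝟘 = ∈-elements⁺ (∈-tabulate⁺ (λ x → (x ⊕ x) ≟ 𝟘) x⊕x≡𝟘)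

  ∈L⁻ : ∀ {x} → x ∈ elements L → x ⊕ x ≡ 𝟘
  ∈L⁻ x∈L = ∈-tabulate⁻ (λ x → (x ⊕ x) ≟ 𝟘) (∈-elements⁻ x∈L)

  0<l : 0 < l
  0<l = subst (0 <_) (length-elements L)
              (length-mono-⊆ {xs = 𝟘 ∷ []} ([] ∷ []) λ { (here refl) → ∈L⁺ (identityˡ 𝟘) })

  halves : ∀ t → ∃[ ds ] (length ds ≤ l × (∀ x → x ⊕ x ≡ t → x ∈ ds))
  halves t with any? (λ y → (y ⊕ y) ≟ t)
  ... | no ∄half = [] , z≤n , λ x x⊕x≡t → contradiction (x , x⊕x≡t) ∄half
  ... | yes (y , y⊕y≡t) =
    map (_⊕ y) (elements L) , ≤-reflexive (trans (length-map _ (elements L)) (length-elements L)) ,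
    λ x x⊕x≡t → subst (_∈ map (_⊕ y) (elements L)) (//-rightDividesˡ y x)
                      (∈-map⁺ (_⊕ y) (∈L⁺ (x⊖y-involution x⊕x≡t)))
    where
      x⊖y-involution : ∀ {x} → x ⊕ x ≡ t → (x ⊕ ⊖ y) ⊕ (x ⊕ ⊖ y) ≡ 𝟘
      x⊖y-involution {x} x⊕x≡t = begin
        (x ⊕ ⊖ y) ⊕ (x ⊕ ⊖ y) ≡⟨ interchange x (⊖ y) x (⊖ y) ⟩
        (x ⊕ x) ⊕ (⊖ y ⊕ ⊖ y) ≡⟨ cong₂ _⊕_ x⊕x≡t (⁻¹-∙-comm y y) ⟩
        t ⊕ ⊖ (y ⊕ y)         ≡⟨ cong (λ z → t ⊕ ⊖ z) y⊕y≡t ⟩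
        t ⊕ ⊖ t               ≡⟨ inverseʳ t ⟩
        𝟘                     ∎
        where open ≡-Reasoning

  -- Restricted sums

  ∃-omitted : ∀ {h g} A → ∣ A ∣ ≡ suc h → g ∈RestrSum h , A →
              ∃[ a ] (a ∈ elements A × Σl (elements A) ≡ a ⊕ g)
  ∃-omitted A ∣A∣≡ (xs , refl , u , xs∈A , refl)
    with find-∉ {ys = xs} (elements-unique A) (≤-reflexive (sym (trans (length-elements A) ∣A∣≡)))
  ... | a , a∈A , a∉xs =
    a , a∈A , sym (Σl-↭ (↭-of-⊆ (¬Any⇒All¬ xs a∉xs ∷ u) (elements-unique A) (∈-∷⁺ʳ a∈A (⊆-elements xs∈A))
                                (≤-reflexive (trans (length-elements A) ∣A∣≡))))

  ∃-restrSum-missing : ∀ {h} → suc h < n → ∃[ A ] (∣ A ∣ ≡ suc h × RestrSumNotAll h A)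
  ∃-restrSum-missing {h} h<n
    with ∃-sublist (suc h) (Unique.allFin⁺ n) (≤-trans (<⇒≤ h<n) (≤-reflexive (sym length-allFin)))
  ... | ys , u , ys≡ , _
    with find-∉ {ys = ys} (Unique.allFin⁺ n) (subst₂ _<_ (sym ys≡) (sym length-allFin) h<n)
  ... | c , _ , c∉ys = fromList ys , trans (∣fromList∣ u) ys≡ , λ all → missed (all (Σl ys ⊕ ⊖ c))
    where
      missed : ¬ (Σl ys ⊕ ⊖ c) ∈RestrSum h , fromList ys
      missed s with ∃-omitted (fromList ys) (trans (∣fromList∣ u) ys≡) s
      ... | a , a∈A , ΣA≡ = c∉ys (subst (_∈ ys) a≡c (∈-tabulate⁻ (_∈? ys) (∈-elements⁻ a∈A)))
        where
          open ≡-Reasoning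
          a≡c : a ≡ c
          a≡c = x∙y⁻¹≈ε⇒x≈y a c (identityʳ-unique (Σl ys) _ (begin
            Σl ys ⊕ (a ⊕ ⊖ c)           ≡⟨ x∙yz≈y∙xz (Σl ys) a (⊖ c) ⟩
            a ⊕ (Σl ys ⊕ ⊖ c)           ≡⟨ ΣA≡ ⟨
            Σl (elements (fromList ys)) ≡⟨ Σl-↭ (elements-fromList-↭ u) ⟩
            Σl ys                       ∎))

  zeroFree-of-Σ≢𝟘 : ∀ {ys h} → Unique ys → length ys ≡ h → Σl ys ≢ 𝟘 →
                    ∃[ A ] (∣ A ∣ ≡ h × ZeroNotInRestrSum h A)
  zeroFree-of-Σ≢𝟘 {ys} {h} u ys≡ Σ≢𝟘 = fromList ys , trans (∣fromList∣ u) ys≡ , zero∉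
    where
      zero∉ : ZeroNotInRestrSum h (fromList ys)
      zero∉ (xs , xs≡ , v , xs∈A , Σxs≡𝟘) = Σ≢𝟘 (begin
        Σl ys                       ≡⟨ Σl-↭ (elements-fromList-↭ u) ⟨
        Σl (elements (fromList ys)) ≡⟨ Σl-↭ (↭-of-⊆ v (elements-unique (fromList ys)) (⊆-elements xs∈A) ∣A∣≤) ⟨
        Σl xs                       ≡⟨ Σxs≡𝟘 ⟩
        𝟘                           ∎)
        where
          open ≡-Reasoning
          ∣A∣≤ : length (elements (fromList ys)) ≤ length xs
          ∣A∣≤ = ≤-reflexive (trans (length-elements (fromList ys)) (trans (∣fromList∣ u) (trans ys≡ (sym xs≡))))

  ∃-zeroFree : ∀ {h} → 1 ≤ h → h < n → ∃[ A ] (∣ A ∣ ≡ h × ZeroNotInRestrSum h A)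
  ∃-zeroFree {suc h} _ h<n
    with ∃-sublist (suc h) (Unique.allFin⁺ n) (≤-trans (<⇒≤ h<n) (≤-reflexive (sym length-allFin)))
  ... | [] , _ , () , _
  ... | a ∷ ys , a∉ys ∷ u , ys≡ , _
    with find-∉ {ys = a ∷ ys} (Unique.allFin⁺ n) (subst₂ _<_ (sym ys≡) (sym length-allFin) h<n)
  ... | c , _ , c∉ with Σl (a ∷ ys) ≟ 𝟘
  ... | no  Σ≢𝟘 = zeroFree-of-Σ≢𝟘 (a∉ys ∷ u) ys≡ Σ≢𝟘
  ... | yes Σ≡𝟘 = zeroFree-of-Σ≢𝟘 (¬Any⇒All¬ ys (c∉ ∘ there) ∷ u) ys≡
                    (λ Σ'≡𝟘 → c∉ (here (∙-cancelʳ (Σl ys) c a (trans Σ'≡𝟘 (sym Σ≡𝟘)))))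

  ∃-pair-summing-to : ∀ {ys} → Unique ys → n + l < length ys + length ys → ∀ t →
                      ∃₂ λ a b → a ∈ ys × b ∈ ys × a ≢ b × a ⊕ b ≡ t
  ∃-pair-summing-to {ys} u bound t = pair (find-∉ {ys = forbidden} u forbidden<)
    where
      ds : List (Fin n)
      ds = proj₁ (halves t)
      partners : List (Fin n)
      partners = map (λ c → t ⊕ ⊖ c) (complement ys)
      forbidden : List (Fin n)
      forbidden = partners ++ ds
      forbidden< : length forbidden < length ys
      forbidden< = begin-strict
        length forbidden                 ≡⟨ length-++ partners ⟩
        length partners + length ds      ≡⟨ cong (_+ length ds) (length-map _ (complement ys)) ⟩
        length (complement ys) + length ds ≤⟨ +-monoʳ-≤ _ (proj₁ (proj₂ (halves t))) ⟩
        length (complement ys) + l         <⟨ +-cancelˡ-< (length ys) _ _ (begin-strict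
          length ys + (length (complement ys) + l) ≡⟨ +-assoc (length ys) _ l ⟨
          length ys + length (complement ys) + l   ≡⟨ cong (_+ l) (length-++-complement u) ⟩
          n + l                                    <⟨ bound ⟩
          length ys + length ys                    ∎) ⟩
        length ys                        ∎
        where open ≤-Reasoning
      pair : ∃[ a ] (a ∈ ys × a ∉ forbidden) → ∃₂ λ a b → a ∈ ys × b ∈ ys × a ≢ b × a ⊕ b ≡ t
      pair (a , a∈ys , a∉) = a , t ⊕ ⊖ a , a∈ys , b∈ys , a≢b , x⊕[y⊖x]≡y a t
        where
          b∈ys : t ⊕ ⊖ a ∈ ys
          b∈ys with (t ⊕ ⊖ a) ∈? ys
          ... | yes b∈ = b∈
          ... | no  b∉ = contradiction (∈-++⁺ˡ (subst (_∈ partners) (x⊖[x⊖y]≡y t a)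
                                                      (∈-map⁺ (λ c → t ⊕ ⊖ c) (∈-complement⁺ b∉)))) a∉
          a≢b : a ≢ t ⊕ ⊖ a
          a≢b a≡b = a∉ (∈-++⁺ʳ partners (proj₂ (proj₂ (halves t)) a (trans (cong (a ⊕_) a≡b) (x⊕[y⊖x]≡y a t))))

  restrSum-total : ∀ {h} A → 2 + h ≤ ∣ A ∣ → n + l ≤ 2 * h + 2 → ∀ g → g ∈RestrSum h , A
  restrSum-total {h} A 2+h≤∣A∣ n+l≤ g =
    drop-pair (∃-sublist (2 + h) (elements-unique A) (≤-trans 2+h≤∣A∣ (≤-reflexive (sym (length-elements A)))))
    where
      drop-pair : ∃[ ys ] (Unique ys × length ys ≡ 2 + h × ys ⊆ elements A) → g ∈RestrSum h , A
      drop-pair (ys , u , ys≡ , ys⊆A)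
        with ∃-pair-summing-to u (subst (λ m → n + l < m + m) (sym ys≡) (≤2h+2⇒<[2+h]+[2+h] n+l≤)) (Σl ys ⊕ ⊖ g)
      ... | a , b , a∈ys , b∈ys , a≢b , a⊕b≡t =
        zs , zs≡ , remove-unique (remove-unique u) ,
        All-∈ₛ (λ p → ys⊆A (proj₁ (∈-remove⁻ (proj₁ (∈-remove⁻ p))))) , Σzs≡g
        where
          b∈ys∖a : b ∈ remove a ys
          b∈ys∖a = ∈-remove⁺ b∈ys a≢b
          zs : List (Fin n)
          zs = remove b (remove a ys)
          zs≡ : length zs ≡ h
          zs≡ = +-cancelˡ-≡ 2 _ _ (trans (sym (trans (length-remove u a∈ys)
                                                      (cong suc (length-remove (remove-unique u) b∈ys∖a)))) ys≡)
          Σzs≡g : Σl zs ≡ g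
          Σzs≡g = ∙-cancelˡ (Σl ys ⊕ ⊖ g) (Σl zs) g (begin
            (Σl ys ⊕ ⊖ g) ⊕ Σl zs ≡⟨ cong (_⊕ Σl zs) a⊕b≡t ⟨
            (a ⊕ b) ⊕ Σl zs       ≡⟨ assoc a b (Σl zs) ⟩
            a ⊕ (b ⊕ Σl zs)       ≡⟨ cong (a ⊕_) (Σl-remove (remove-unique u) b∈ys∖a) ⟨
            a ⊕ Σl (remove a ys)  ≡⟨ Σl-remove u a∈ys ⟨
            Σl ys                 ≡⟨ //-rightDividesˡ g (Σl ys) ⟨
            (Σl ys ⊕ ⊖ g) ⊕ g     ∎)
            where open ≡-Reasoning

  card≤-of-restrSumNotAll : ∀ {h} → n + l ≤ 2 * h + 2 → ∀ A → RestrSumNotAll h A → ∣ A ∣ ≤ suc h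
  card≤-of-restrSumNotAll {h} n+l≤ A ¬total with ∣ A ∣ ≤? suc h
  ... | yes ∣A∣≤ = ∣A∣≤
  ... | no  ∣A∣≰ = contradiction (restrSum-total A (≰⇒> ∣A∣≰) n+l≤) ¬total

  -- the sum of the elements outside bs, by Σl-complement
  coSum : List (Fin n) → Fin n
  coSum bs = ΣG ⊕ ⊖ Σl bs

  coSum-≡ : ∀ bs {z} → z ⊕ Σl bs ≡ ΣG → coSum bs ≡ z
  coSum-≡ bs {z} z⊕Σ≡ΣG = trans (cong (_⊕ ⊖ Σl bs) (sym z⊕Σ≡ΣG)) (//-rightDividesʳ (Σl bs) z)

  ⊕coSum : ∀ bs {z} → coSum bs ≡ z → z ⊕ Σl bs ≡ ΣG
  ⊕coSum bs refl = //-rightDividesˡ (Σl bs) ΣG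

  -- For A = complement bs this says ΣA ∉ A; the restricted (|A| − 1)-sums of A are the ΣA ⊖ a.
  Absorbing : List (Fin n) → Set
  Absorbing bs = Unique bs × coSum bs ∈ bs

  ∃Absorbing : ℕ → Set
  ∃Absorbing k = ∃[ bs ] (length bs ≡ k × Absorbing bs)

  zeroFree-of-absorbing : ∀ {h k} → suc h + k ≡ n → ∃Absorbing k →
                          ∃[ A ] (∣ A ∣ ≡ suc h × ZeroNotInRestrSum h A)
  zeroFree-of-absorbing {h} {k} n≡ (bs , bs≡ , u , coSum∈bs) = A , ∣A∣≡ , zero∉
    where
      A : Subset n
      A = fromList (complement bs)
      ∣A∣≡ : ∣ A ∣ ≡ suc h
      ∣A∣≡ = trans (∣fromList∣ (complement-unique bs))
                   (length-complement u (trans (cong (_+ suc h) bs≡) (trans (+-comm k (suc h)) n≡)))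
      zero∉ : ZeroNotInRestrSum h A
      zero∉ s with ∃-omitted A ∣A∣≡ s
      ... | a , a∈A , ΣA≡a⊕𝟘 =
        ∈-complement⁻ (∈-tabulate⁻ (_∈? complement bs) (∈-elements⁻ a∈A)) (subst (_∈ bs) coSum≡a coSum∈bs)
        where
          open ≡-Reasoning
          coSum≡a : coSum bs ≡ a
          coSum≡a = begin
            coSum bs                ≡⟨ coSum-≡ bs (trans (comm _ _) (Σl-complement u)) ⟩
            Σl (complement bs)      ≡⟨ Σl-↭ (elements-fromList-↭ (complement-unique bs)) ⟨
            Σl (elements A)         ≡⟨ ΣA≡a⊕𝟘 ⟩
            a ⊕ 𝟘                   ≡⟨ identityʳ a ⟩
            a                       ∎

  zero∈-of-¬absorbing : ∀ {h k} → suc h + k ≡ n → ¬ ∃Absorbing k → ∀ A → ∣ A ∣ ≡ suc h → 𝟘 ∈RestrSum h , A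
  zero∈-of-¬absorbing {h} {k} n≡ ¬absorbing A ∣A∣≡ =
    remove ΣA es , es∖ΣA≡ , remove-unique ue , All-∈ₛ (λ p → proj₁ (∈-remove⁻ p)) ,
    identityʳ-unique ΣA _ (sym (Σl-remove ue ΣA∈A))
    where
      es : List (Fin n)
      es = elements A
      ue : Unique es
      ue = elements-unique A
      ΣA : Fin n
      ΣA = Σl es
      es≡ : length es ≡ suc h
      es≡ = trans (length-elements A) ∣A∣≡
      ΣA∈A : ΣA ∈ es
      ΣA∈A with ΣA ∈? es
      ... | yes ΣA∈ = ΣA∈
      ... | no  ΣA∉ = contradiction
        (complement es , length-complement ue (trans (cong (_+ k) es≡) n≡) , complement-unique es ,
         subst (_∈ complement es) (sym (coSum-≡ (complement es) (Σl-complement ue))) (∈-complement⁺ ΣA∉))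
        ¬absorbing
      es∖ΣA≡ : length (remove ΣA es) ≡ h
      es∖ΣA≡ = suc-injective (trans (sym (length-remove ue ΣA∈A)) es≡)

  Z-upper : ∀ {h} → n + l ≤ 2 * h + 2 → ∀ A → ZeroNotInRestrSum h A → ∣ A ∣ ≤ suc h
  Z-upper n+l≤ A zero∉ = card≤-of-restrSumNotAll n+l≤ A (λ total → zero∉ (total 𝟘))

  C≡suc : ∀ {h} → suc h < n → n + l ≤ 2 * h + 2 → C≡ G h (suc h)
  C≡suc h<n n+l≤ = ∃-restrSum-missing h<n , card≤-of-restrSumNotAll n+l≤

  Z≡suc-of-absorbing : ∀ {h k} → suc h + k ≡ n → n + l ≤ 2 * h + 2 → ∃Absorbing k → Z≡ G h (suc h)
  Z≡suc-of-absorbing n≡ n+l≤ absorbing = zeroFree-of-absorbing n≡ absorbing , Z-upper n+l≤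

  Z≡-of-¬absorbing : ∀ {h k} → 1 ≤ h → suc h + k ≡ n → n + l ≤ 2 * h + 2 → ¬ ∃Absorbing k → Z≡ G h h
  Z≡-of-¬absorbing {h} {k} 1≤h n≡ n+l≤ ¬absorbing =
    ∃-zeroFree 1≤h (≤-trans (m≤m+n (suc h) k) (≤-reflexive n≡)) , upper
    where
      upper : ∀ A → ZeroNotInRestrSum h A → ∣ A ∣ ≤ h
      upper A zero∉ with m≤n⇒m<n∨m≡n (Z-upper n+l≤ A zero∉)
      ... | inj₁ ∣A∣<suc-h = ≤-pred ∣A∣<suc-h
      ... | inj₂ ∣A∣≡suc-h = contradiction (zero∈-of-¬absorbing n≡ ¬absorbing A ∣A∣≡suc-h) zero∉

  -- Pairings and the sum of all elements

  module _ (ι : Fin n → Fin n) (ι-involutive : ∀ x → ι (ι x) ≡ x) where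

    FreeInvolutionOn : List (Fin n) → Set
    FreeInvolutionOn ys = ∀ {y} → y ∈ ys → ι y ∈ ys × ι y ≢ y

    freeInvolutionOn-remove : ∀ {y ys} → Unique (y ∷ ys) → FreeInvolutionOn (y ∷ ys) →
                              FreeInvolutionOn (remove (ι y) ys)
    freeInvolutionOn-remove {y} (y∉ys ∷ _) free {z} z∈ with ∈-remove⁻ z∈
    ... | z∈ys , ιy≢z with free (there z∈ys)
    ... | here ιz≡y    , _    = contradiction (sym (trans (sym (ι-involutive z)) (cong ι ιz≡y))) ιy≢z
    ... | there ιz∈ys , ιz≢z = ∈-remove⁺ ιz∈ys (λ ιy≡ιz → All.lookup y∉ys z∈ys (ι-injective ιy≡ιz)) , ιz≢z
      where
        ι-injective : ∀ {a b} → ι a ≡ ι b → a ≡ b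
        ι-injective {a} {b} ιa≡ιb = trans (sym (ι-involutive a)) (trans (cong ι ιa≡ιb) (ι-involutive b))

    Σl-pairs : ∀ c {ys} → Unique ys → FreeInvolutionOn ys → (∀ {y} → y ∈ ys → y ⊕ ι y ≡ c) →
               ∃[ j ] (length ys ≡ 2 * j × Σl ys ≡ j · c)
    Σl-pairs c {ys} = go (length ys) ≤-refl
      where
        -- fuel f, because remove (ι y) ys is not a structural subterm of y ∷ ys
        go : ∀ f {ys} → length ys ≤ f → Unique ys → FreeInvolutionOn ys → (∀ {y} → y ∈ ys → y ⊕ ι y ≡ c) →
             ∃[ j ] (length ys ≡ 2 * j × Σl ys ≡ j · c)
        go _       {[]}     _          _                _    _    = 0 , refl , refl
        go (suc f) {y ∷ ys} (s≤s ys≤f) u@(_ ∷ ys-unique) free pair with free (here refl)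
        ... | here ιy≡y , ιy≢y = contradiction ιy≡y ιy≢y
        ... | there ιy∈ys , _
          with go f (≤-trans (<⇒≤ (length-remove< ιy∈ys)) ys≤f) (remove-unique ys-unique)
                  (freeInvolutionOn-remove u free) (λ p → pair (there (proj₁ (∈-remove⁻ p))))
        ... | j , rest≡ , Σrest≡ = suc j , length≡ , Σ≡
          where
            length≡ : suc (length ys) ≡ 2 * suc j
            length≡ = trans (cong suc (trans (length-remove ys-unique ιy∈ys) (cong suc rest≡))) (sym (*-suc 2 j))
            Σ≡ : y ⊕ Σl ys ≡ c ⊕ j · c
            Σ≡ = begin
              y ⊕ Σl ys                         ≡⟨ cong (y ⊕_) (Σl-remove ys-unique ιy∈ys) ⟩
              y ⊕ (ι y ⊕ Σl (remove (ι y) ys)) ≡⟨ assoc y (ι y) _ ⟨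
              (y ⊕ ι y) ⊕ Σl (remove (ι y) ys) ≡⟨ cong₂ _⊕_ (pair (here refl)) Σrest≡ ⟩
              c ⊕ j · c                         ∎
              where open ≡-Reasoning

  ·-+ : ∀ a b x → (a + b) · x ≡ a · x ⊕ b · x
  ·-+ zero    b x = sym (identityˡ _)
  ·-+ (suc a) b x = trans (cong (x ⊕_) (·-+ a b x)) (sym (assoc x _ _))

  ·-* : ∀ a b x → (a * b) · x ≡ a · (b · x)
  ·-* zero    b x = refl
  ·-* (suc a) b x = trans (·-+ b (a * b) x) (cong (b · x ⊕_) (·-* a b x))

  ·-𝟘 : ∀ a → a · 𝟘 ≡ 𝟘
  ·-𝟘 zero    = refl
  ·-𝟘 (suc a) = trans (identityˡ _) (·-𝟘 a)

  2·x≡x⊕x : ∀ x → 2 · x ≡ x ⊕ x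
  2·x≡x⊕x x = cong (x ⊕_) (identityʳ x)

  4·x≡𝟘 : ∀ {x} → (x ⊕ x) ⊕ (x ⊕ x) ≡ 𝟘 → 4 · x ≡ 𝟘
  4·x≡𝟘 {x} 4x≡𝟘 = trans (·-+ 2 2 x) (trans (cong₂ _⊕_ (2·x≡x⊕x x) (2·x≡x⊕x x)) 4x≡𝟘)

  ·-% : ∀ m .{{_ : NonZero m}} {x} → m · x ≡ 𝟘 → ∀ j → j · x ≡ (j % m) · x
  ·-% m {x} m·x≡𝟘 j = begin
    j · x                             ≡⟨ cong (_· x) (m≡m%n+[m/n]*n j m) ⟩
    (j % m + (j / m) * m) · x         ≡⟨ ·-+ (j % m) _ x ⟩
    (j % m) · x ⊕ ((j / m) * m) · x   ≡⟨ cong ((j % m) · x ⊕_) (·-* (j / m) m x) ⟩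
    (j % m) · x ⊕ (j / m) · (m · x)   ≡⟨ cong (λ y → (j % m) · x ⊕ (j / m) · y) m·x≡𝟘 ⟩
    (j % m) · x ⊕ (j / m) · 𝟘         ≡⟨ cong ((j % m) · x ⊕_) (·-𝟘 (j / m)) ⟩
    (j % m) · x ⊕ 𝟘                   ≡⟨ identityʳ _ ⟩
    (j % m) · x                       ∎
    where open ≡-Reasoning

  ·-cancel-involution : ∀ {e f} j → e ⊕ e ≡ 𝟘 → f ⊕ f ≡ 𝟘 → j · e ≡ j · f → j · e ≡ 𝟘 ⊎ e ≡ f
  ·-cancel-involution {e} {f} j e⊕e≡𝟘 f⊕f≡𝟘 je≡jf with m%2-cases j
  ... | inj₁ j%2≡0 = inj₁ (trans (·-% 2 (trans (2·x≡x⊕x e) e⊕e≡𝟘) j) (cong (_· e) j%2≡0))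
  ... | inj₂ j%2≡1 = inj₂ (begin
    e           ≡⟨ identityʳ e ⟨
    1 · e       ≡⟨ cong (_· e) j%2≡1 ⟨
    (j % 2) · e ≡⟨ ·-% 2 (trans (2·x≡x⊕x e) e⊕e≡𝟘) j ⟨
    j · e       ≡⟨ je≡jf ⟩
    j · f       ≡⟨ ·-% 2 (trans (2·x≡x⊕x f) f⊕f≡𝟘) j ⟩
    (j % 2) · f ≡⟨ cong (_· f) j%2≡1 ⟩
    1 · f       ≡⟨ identityʳ f ⟩
    f           ∎)
    where open ≡-Reasoning

  ΣL≡ΣG : Σl (elements L) ≡ ΣG
  ΣL≡ΣG = begin
    Σl (elements L)                                ≡⟨ identityʳ _ ⟨
    Σl (elements L) ⊕ 𝟘                            ≡⟨ cong (Σl (elements L) ⊕_) Σ[G∖L]≡𝟘 ⟨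
    Σl (elements L) ⊕ Σl (complement (elements L)) ≡⟨ Σl-complement (elements-unique L) ⟩
    ΣG                                             ∎
    where
      open ≡-Reasoning
      free : FreeInvolutionOn ⊖_ ⁻¹-involutive (complement (elements L))
      free {y} y∉L = ∈-complement⁺ (y⊕y≢𝟘 ∘ ⊖-involution) ,
                     λ ⊖y≡y → y⊕y≢𝟘 (trans (cong (y ⊕_) (sym ⊖y≡y)) (inverseʳ y))
        where
          y⊕y≢𝟘 : y ⊕ y ≢ 𝟘
          y⊕y≢𝟘 y⊕y≡𝟘 = ∈-complement⁻ y∉L (∈L⁺ y⊕y≡𝟘)
          ⊖-involution : ⊖ y ∈ elements L → y ⊕ y ≡ 𝟘
          ⊖-involution ⊖y∈L = ⁻¹-injective (trans (sym (⁻¹-∙-comm y y)) (trans (∈L⁻ ⊖y∈L) (sym ε⁻¹≈ε)))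
      Σ[G∖L]≡𝟘 : Σl (complement (elements L)) ≡ 𝟘
      Σ[G∖L]≡𝟘 with Σl-pairs ⊖_ ⁻¹-involutive 𝟘 (complement-unique (elements L)) free (λ {y} _ → inverseʳ y)
      ... | j , _ , Σ≡ = trans Σ≡ (·-𝟘 j)

  ΣL≡j·e : ∀ {e} → e ∈ elements L → e ≢ 𝟘 → ∃[ j ] (l ≡ 2 * j × Σl (elements L) ≡ j · e)
  ΣL≡j·e {e} e∈L e≢𝟘 =
    subst (λ m → ∃[ j ] (m ≡ 2 * j × Σl (elements L) ≡ j · e)) (length-elements L)
          (Σl-pairs (_⊕ e) ⊕e-involutive e (elements-unique L) free (λ {y} y∈L → y⊕[y⊕e]≡e (∈L⁻ y∈L)))
    where
      e⊕e≡𝟘 : e ⊕ e ≡ 𝟘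
      e⊕e≡𝟘 = ∈L⁻ e∈L
      ⊕e-involutive : ∀ x → (x ⊕ e) ⊕ e ≡ x
      ⊕e-involutive x = trans (assoc x e e) (trans (cong (x ⊕_) e⊕e≡𝟘) (identityʳ x))
      y⊕[y⊕e]≡e : ∀ {y} → y ⊕ y ≡ 𝟘 → y ⊕ (y ⊕ e) ≡ e
      y⊕[y⊕e]≡e {y} y⊕y≡𝟘 = trans (sym (assoc y y e)) (trans (cong (_⊕ e) y⊕y≡𝟘) (identityˡ e))
      free : FreeInvolutionOn (_⊕ e) ⊕e-involutive (elements L)
      free {y} y∈L = ∈L⁺ (trans (interchange y e y e) (trans (cong₂ _⊕_ (∈L⁻ y∈L) e⊕e≡𝟘) (identityˡ 𝟘))) ,
                     λ y⊕e≡y → e≢𝟘 (identityʳ-unique y e y⊕e≡y)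

  Σl-doubles : ∀ xs → All (λ x → x ⊕ x ≡ 𝟘) xs → Σl xs ⊕ Σl xs ≡ 𝟘
  Σl-doubles []       []                 = identityˡ 𝟘
  Σl-doubles (x ∷ xs) (x⊕x≡𝟘 ∷ doubles) =
    trans (interchange x _ x _) (trans (cong₂ _⊕_ x⊕x≡𝟘 (Σl-doubles xs doubles)) (identityˡ 𝟘))

  ΣG⊕ΣG≡𝟘 : ΣG ⊕ ΣG ≡ 𝟘
  ΣG⊕ΣG≡𝟘 = subst (λ s → s ⊕ s ≡ 𝟘) ΣL≡ΣG (Σl-doubles (elements L) (All.tabulate ∈L⁻))

  3·ΣG≡ΣG : 3 · ΣG ≡ ΣG
  3·ΣG≡ΣG = trans (cong (ΣG ⊕_) (trans (2·x≡x⊕x ΣG) ΣG⊕ΣG≡𝟘)) (identityʳ ΣG)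

  -- ΣL is j · ΣG and j · f for the same j = l / 2, and the parity of j decides.
  ΣG≢𝟘⇒ΣG-only-involution : ΣG ≢ 𝟘 → ∀ {f} → f ∈ elements L → f ≡ 𝟘 ⊎ f ≡ ΣG
  ΣG≢𝟘⇒ΣG-only-involution ΣG≢𝟘 {f} f∈L with f ≟ 𝟘
  ... | yes f≡𝟘 = inj₁ f≡𝟘
  ... | no  f≢𝟘 with ΣL≡j·e (∈L⁺ ΣG⊕ΣG≡𝟘) ΣG≢𝟘 | ΣL≡j·e f∈L f≢𝟘
  ... | j , l≡2j , ΣL≡jΣG | j′ , l≡2j′ , ΣL≡j′f with *-cancelˡ-≡ j j′ 2 (trans (sym l≡2j) l≡2j′)
  ... | refl with ·-cancel-involution j ΣG⊕ΣG≡𝟘 (∈L⁻ f∈L) (trans (sym ΣL≡jΣG) ΣL≡j′f)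
  ... | inj₁ jΣG≡𝟘 = contradiction (trans (sym ΣL≡ΣG) (trans ΣL≡jΣG jΣG≡𝟘)) ΣG≢𝟘
  ... | inj₂ ΣG≡f  = inj₂ (sym ΣG≡f)

  ΣG≢𝟘⇒l≡2 : ΣG ≢ 𝟘 → l ≡ 2
  ΣG≢𝟘⇒l≡2 ΣG≢𝟘 = trans (sym (length-elements L)) (≤-antisym
    (length-mono-⊆ {ys = 𝟘 ∷ ΣG ∷ []} (elements-unique L)
                   (λ f∈L → [ here , there ∘ here ]′ (ΣG≢𝟘⇒ΣG-only-involution ΣG≢𝟘 f∈L)))
    (length-mono-⊆ {xs = 𝟘 ∷ ΣG ∷ []} (((ΣG≢𝟘 ∘ sym) ∷ []) ∷ [] ∷ [])
                   λ { (here refl) → ∈L⁺ (identityˡ 𝟘) ; (there (here refl)) → ∈L⁺ ΣG⊕ΣG≡𝟘 }))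

  l≡2⇒ΣG≢𝟘 : l ≡ 2 → ΣG ≢ 𝟘
  l≡2⇒ΣG≢𝟘 l≡2 ΣG≡𝟘
    with find-∉ {ys = 𝟘 ∷ []} (elements-unique L) (≤-reflexive (sym (trans (length-elements L) l≡2)))
  ... | e , e∈L , e∉[𝟘] with ΣL≡j·e e∈L (e∉[𝟘] ∘ here)
  ... | j , l≡2j , ΣL≡je with *-cancelˡ-≡ 1 j 2 (trans (sym l≡2) l≡2j)
  ... | refl = e∉[𝟘] (here (begin
    e               ≡⟨ identityʳ e ⟨
    1 · e           ≡⟨ ΣL≡je ⟨
    Σl (elements L) ≡⟨ ΣL≡ΣG ⟩
    ΣG              ≡⟨ ΣG≡𝟘 ⟩
    𝟘               ∎))
    where open ≡-Reasoning

  -- Absorbing sets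

  absorbing-1 : ∀ {b} → b ⊕ b ≡ ΣG → ∃Absorbing 1
  absorbing-1 {b} b⊕b≡ΣG =
    b ∷ [] , refl , [] ∷ [] , here (coSum-≡ (b ∷ []) (trans (cong (b ⊕_) (identityʳ b)) b⊕b≡ΣG))

  ¬absorbing-1 : (∀ b → b ⊕ b ≢ ΣG) → ¬ ∃Absorbing 1
  ¬absorbing-1 ¬half (b ∷ [] , _ , _ , here coSum≡b) =
    ¬half b (trans (cong (b ⊕_) (sym (identityʳ b))) (⊕coSum (b ∷ []) coSum≡b))

  absorbing-2 : ∀ {x} → 3 · x ≢ ΣG → ∃Absorbing 2
  absorbing-2 {x} 3x≢ΣG =
    x ∷ y ∷ [] , refl , (x≢y ∷ []) ∷ [] ∷ [] , here (coSum-≡ (x ∷ y ∷ []) x⊕Σ≡ΣG)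
    where
      y : Fin n
      y = ΣG ⊕ ⊖ (x ⊕ x)
      x⊕Σ≡ΣG : x ⊕ (x ⊕ (y ⊕ 𝟘)) ≡ ΣG
      x⊕Σ≡ΣG = begin
        x ⊕ (x ⊕ (y ⊕ 𝟘)) ≡⟨ cong (λ z → x ⊕ (x ⊕ z)) (identityʳ y) ⟩
        x ⊕ (x ⊕ y)       ≡⟨ assoc x x y ⟨
        (x ⊕ x) ⊕ y       ≡⟨ x⊕[y⊖x]≡y (x ⊕ x) ΣG ⟩
        ΣG                ∎
        where open ≡-Reasoning
      x≢y : x ≢ y
      x≢y x≡y = 3x≢ΣG (subst (λ z → x ⊕ (x ⊕ (z ⊕ 𝟘)) ≡ ΣG) (sym x≡y) x⊕Σ≡ΣG)

  ¬absorbing-2 : (∀ x → 3 · x ≡ 𝟘) → ¬ ∃Absorbing 2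
  ¬absorbing-2 3·≡𝟘 (b₁ ∷ b₂ ∷ [] , _ , (b₁≢b₂ ∷ []) ∷ _ , coSum∈) = b₁≢b₂ (b₁≡b₂ coSum∈)
    where
      cancel-twice : ∀ x {y z} → x ⊕ (x ⊕ y) ≡ x ⊕ (x ⊕ z) → y ≡ z
      cancel-twice x e = ∙-cancelˡ x _ _ (∙-cancelˡ x _ _ e)
      ΣG≡𝟘 : ΣG ≡ 𝟘
      ΣG≡𝟘 = trans (sym 3·ΣG≡ΣG) (3·≡𝟘 ΣG)
      b₁≡b₂ : coSum (b₁ ∷ b₂ ∷ []) ∈ b₁ ∷ b₂ ∷ [] → b₁ ≡ b₂
      b₁≡b₂ (here coSum≡b₁) =
        sym (∙-cancelʳ 𝟘 b₂ b₁ (cancel-twice b₁ (trans (trans (⊕coSum (b₁ ∷ b₂ ∷ []) coSum≡b₁) ΣG≡𝟘) (sym (3·≡𝟘 b₁)))))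
      b₁≡b₂ (there (here coSum≡b₂)) =
        ∙-cancelʳ 𝟘 b₁ b₂ (cancel-twice b₂ (trans (cong (b₂ ⊕_) (x∙yz≈y∙xz b₂ b₁ 𝟘))
                                          (trans (trans (⊕coSum (b₁ ∷ b₂ ∷ []) coSum≡b₂) ΣG≡𝟘) (sym (3·≡𝟘 b₂)))))

  absorbing-of-Σ≡ΣG : ∀ {bs} → Unique bs → 𝟘 ∈ bs → Σl bs ≡ ΣG → Absorbing bs
  absorbing-of-Σ≡ΣG {bs} u 𝟘∈bs Σ≡ΣG = u , subst (_∈ bs) (sym (coSum-≡ bs (trans (identityˡ _) Σ≡ΣG))) 𝟘∈bs

  <-of-halves : ∀ {k} (ds : List (Fin n)) → length ds ≤ l → l + suc k ≤ n → k + length ds < length (allFin n)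
  <-of-halves {k} ds ds≤l l+k<n = subst (k + length ds <_) (sym length-allFin) (begin-strict
    k + length ds ≤⟨ +-monoʳ-≤ k ds≤l ⟩
    k + l         <⟨ s≤s (≤-reflexive (+-comm k l)) ⟩
    suc (l + k)   ≡⟨ +-suc l k ⟨
    l + suc k     ≤⟨ l+k<n ⟩
    n             ∎)
    where open ≤-Reasoning

  -- {𝟘, x, ΣG ⊖ x} sums to ΣG and is duplicate-free once x ∉ {𝟘, ΣG} and x ⊕ x ≢ ΣG.
  absorbing-3 : l + 3 ≤ n → ∃Absorbing 3
  absorbing-3 l+3≤n = build (find-∉ {ys = 𝟘 ∷ ΣG ∷ ds} (Unique.allFin⁺ n) (<-of-halves {2} ds ds≤l l+3≤n))
    where
      ds : List (Fin n)
      ds = proj₁ (halves ΣG)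
      ds≤l : length ds ≤ l
      ds≤l = proj₁ (proj₂ (halves ΣG))
      build : ∃[ x ] (x ∈ allFin n × x ∉ 𝟘 ∷ ΣG ∷ ds) → ∃Absorbing 3
      build (x , _ , x∉) = 𝟘 ∷ x ∷ w ∷ [] , refl , absorbing-of-Σ≡ΣG unique (here refl) Σ≡ΣG
        where
          w : Fin n
          w = ΣG ⊕ ⊖ x
          Σ≡ΣG : 𝟘 ⊕ (x ⊕ (w ⊕ 𝟘)) ≡ ΣG
          Σ≡ΣG = trans (identityˡ _) (trans (cong (x ⊕_) (identityʳ w)) (x⊕[y⊖x]≡y x ΣG))
          𝟘≢x : 𝟘 ≢ x
          𝟘≢x 𝟘≡x = x∉ (here (sym 𝟘≡x))
          𝟘≢w : 𝟘 ≢ w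
          𝟘≢w 𝟘≡w = x∉ (there (here (sym (x∙y⁻¹≈ε⇒x≈y ΣG x (sym 𝟘≡w)))))
          x≢w : x ≢ w
          x≢w x≡w = x∉ (there (there (proj₂ (proj₂ (halves ΣG)) x (trans (cong (x ⊕_) x≡w) (x⊕[y⊖x]≡y x ΣG)))))
          unique : Unique (𝟘 ∷ x ∷ w ∷ [])
          unique = (𝟘≢x ∷ 𝟘≢w ∷ []) ∷ (x≢w ∷ []) ∷ [] ∷ []

  -- {𝟘, x, y, ΣG ⊖ (x ⊕ y)} with x ≢ 𝟘; y avoids the at most l + 4 values making it degenerate.
  absorbing-4 : l + 5 ≤ n → ∃Absorbing 4
  absorbing-4 l+5≤n = pick-x (find-∉ {ys = 𝟘 ∷ []} (Unique.allFin⁺ n) (<-of-halves {1} [] z≤n l+2≤n))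
    where
      l+2≤n : l + 2 ≤ n
      l+2≤n = ≤-trans (+-monoʳ-≤ l (s≤s (s≤s z≤n))) l+5≤n
      pick-x : ∃[ x ] (x ∈ allFin n × x ∉ 𝟘 ∷ []) → ∃Absorbing 4
      pick-x (x , _ , x∉) = pick-y (find-∉ {ys = forbidden} (Unique.allFin⁺ n) (<-of-halves {4} ds ds≤l l+5≤n))
        where
          ds : List (Fin n)
          ds = proj₁ (halves (ΣG ⊕ ⊖ x))
          ds≤l : length ds ≤ l
          ds≤l = proj₁ (proj₂ (halves (ΣG ⊕ ⊖ x)))
          forbidden : List (Fin n)
          forbidden = 𝟘 ∷ x ∷ ΣG ⊕ ⊖ x ∷ ΣG ⊕ ⊖ (x ⊕ x) ∷ ds
          pick-y : ∃[ y ] (y ∈ allFin n × y ∉ forbidden) → ∃Absorbing 4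
          pick-y (y , _ , y∉) = 𝟘 ∷ x ∷ y ∷ w ∷ [] , refl , absorbing-of-Σ≡ΣG unique (here refl) Σ≡ΣG
            where
              open ≡-Reasoning
              w : Fin n
              w = ΣG ⊕ ⊖ (x ⊕ y)
              x⊕y⊕w≡ΣG : (x ⊕ y) ⊕ w ≡ ΣG
              x⊕y⊕w≡ΣG = x⊕[y⊖x]≡y (x ⊕ y) ΣG
              Σ≡ΣG : 𝟘 ⊕ (x ⊕ (y ⊕ (w ⊕ 𝟘))) ≡ ΣG
              Σ≡ΣG = begin
                𝟘 ⊕ (x ⊕ (y ⊕ (w ⊕ 𝟘))) ≡⟨ identityˡ _ ⟩
                x ⊕ (y ⊕ (w ⊕ 𝟘))       ≡⟨ cong (λ z → x ⊕ (y ⊕ z)) (identityʳ w) ⟩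
                x ⊕ (y ⊕ w)             ≡⟨ assoc x y w ⟨
                (x ⊕ y) ⊕ w             ≡⟨ x⊕y⊕w≡ΣG ⟩
                ΣG                      ∎
              𝟘≢x : 𝟘 ≢ x
              𝟘≢x 𝟘≡x = x∉ (here (sym 𝟘≡x))
              𝟘≢y : 𝟘 ≢ y
              𝟘≢y 𝟘≡y = y∉ (here (sym 𝟘≡y))
              𝟘≢w : 𝟘 ≢ w
              𝟘≢w 𝟘≡w = y∉ (there (there (here (≡-⊖ (sym (x∙y⁻¹≈ε⇒x≈y ΣG (x ⊕ y) (sym 𝟘≡w)))))))
              x≢y : x ≢ y
              x≢y x≡y = y∉ (there (here (sym x≡y)))
              x≢w : x ≢ w
              x≢w x≡w = y∉ (there (there (there (here (≡-⊖ (begin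
                (x ⊕ x) ⊕ y ≡⟨ xy∙z≈xz∙y x y x ⟨
                (x ⊕ y) ⊕ x ≡⟨ cong ((x ⊕ y) ⊕_) x≡w ⟩
                (x ⊕ y) ⊕ w ≡⟨ x⊕y⊕w≡ΣG ⟩
                ΣG          ∎))))))
              y≢w : y ≢ w
              y≢w y≡w = y∉ (there (there (there (there (proj₂ (proj₂ (halves (ΣG ⊕ ⊖ x))) y (≡-⊖ (begin
                x ⊕ (y ⊕ y) ≡⟨ assoc x y y ⟨
                (x ⊕ y) ⊕ y ≡⟨ cong ((x ⊕ y) ⊕_) y≡w ⟩
                (x ⊕ y) ⊕ w ≡⟨ x⊕y⊕w≡ΣG ⟩
                ΣG          ∎)))))))
              unique : Unique (𝟘 ∷ x ∷ y ∷ w ∷ [])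
              unique = (𝟘≢x ∷ 𝟘≢y ∷ 𝟘≢w ∷ []) ∷ (x≢y ∷ x≢w ∷ []) ∷ (y≢w ∷ []) ∷ [] ∷ []

  absorbing-+2 : ∀ {k} → ∃Absorbing k → l + (k + k) < n → ∃Absorbing (2 + k)
  absorbing-+2 {k} (bs , bs≡ , u , coSum∈bs) bound = extend (find-∉ {ys = forbidden} (Unique.allFin⁺ n) forbidden<)
    where
      forbidden : List (Fin n)
      forbidden = elements L ++ bs ++ map ⊖_ bs
      forbidden< : length forbidden < length (allFin n)
      forbidden< = subst₂ _<_ (sym forbidden≡) (sym length-allFin) bound
        where
          forbidden≡ : length forbidden ≡ l + (k + k)
          forbidden≡ = trans (length-++ (elements L))
            (cong₂ _+_ (length-elements L) (trans (length-++ bs) (cong₂ _+_ bs≡ (trans (length-map ⊖_ bs) bs≡))))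
      extend : ∃[ t ] (t ∈ allFin n × t ∉ forbidden) → ∃Absorbing (2 + k)
      extend (t , _ , t∉) =
        t ∷ ⊖ t ∷ bs , cong (2 +_) bs≡ , unique , subst (_∈ t ∷ ⊖ t ∷ bs) coSum≡ (there (there coSum∈bs))
        where
          t∉bs : t ∉ bs
          t∉bs t∈bs = t∉ (∈-++⁺ʳ (elements L) (∈-++⁺ˡ t∈bs))
          ⊖t∉bs : ⊖ t ∉ bs
          ⊖t∉bs ⊖t∈bs = t∉ (∈-++⁺ʳ (elements L) (∈-++⁺ʳ bs
                          (subst (_∈ map ⊖_ bs) (⁻¹-involutive t) (∈-map⁺ ⊖_ ⊖t∈bs))))
          t≢⊖t : t ≢ ⊖ t
          t≢⊖t t≡⊖t = t∉ (∈-++⁺ˡ (∈L⁺ (trans (cong (t ⊕_) t≡⊖t) (inverseʳ t))))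
          unique : Unique (t ∷ ⊖ t ∷ bs)
          unique = (t≢⊖t ∷ ¬Any⇒All¬ bs t∉bs) ∷ ¬Any⇒All¬ bs ⊖t∉bs ∷ u
          coSum≡ : coSum bs ≡ coSum (t ∷ ⊖ t ∷ bs)
          coSum≡ = cong (λ s → ΣG ⊕ ⊖ s) (sym (\\-leftDividesˡ t (Σl bs)))

  absorbing : ∀ k → 1 ≤ k → l + (k + k) ≤ n →
              (k ≡ 1 → ∃[ b ] b ⊕ b ≡ ΣG) → (k ≡ 2 → ∃[ x ] 3 · x ≢ ΣG) → ∃Absorbing k
  absorbing 1 _ _ half _   = absorbing-1 (proj₂ (half refl))
  absorbing 2 _ _ _ triple = absorbing-2 (proj₂ (triple refl))
  absorbing 3 _ bound _ _  = absorbing-3 (≤-trans (+-monoʳ-≤ l (s≤s (s≤s (s≤s z≤n)))) bound)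
  absorbing 4 _ bound _ _  = absorbing-4 (≤-trans (+-monoʳ-≤ l (s≤s (s≤s (s≤s (s≤s (s≤s z≤n)))))) bound)
  absorbing (suc (suc k@(suc (suc (suc _))))) _ bound _ _ =
    absorbing-+2 (absorbing k (s≤s z≤n) (<⇒≤ k-bound) (λ ()) (λ ())) k-bound
    where
      k-bound : l + (k + k) < n
      k-bound = <-≤-trans (+-monoʳ-< l (+-mono-< (m<n+m k {2} (s≤s z≤n)) (m<n+m k {2} (s≤s z≤n)))) bound

  module WithExponent {q : ℕ} (exponent : IsExponent q) where

    q·x≡𝟘 : ∀ x → q · x ≡ 𝟘
    q·x≡𝟘 = proj₁ (proj₂ exponent)

    q-minimal : ∀ m → 0 < m → (∀ x → m · x ≡ 𝟘) → q ≤ m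
    q-minimal = proj₂ (proj₂ exponent)

    ∃-triple≢ΣG : q ≢ 3 → 2 ≤ n → ∃[ x ] 3 · x ≢ ΣG
    ∃-triple≢ΣG q≢3 2≤n with any? (λ x → ¬? ((3 · x) ≟ ΣG))
    ... | yes found = found
    ... | no  ∄     with Fin-two-distinct 2≤n
    ... | x , y , x≢y = contradiction (trans (trivial x) (sym (trivial y))) x≢y
      where
        3·≡𝟘 : ∀ z → 3 · z ≡ 𝟘
        3·≡𝟘 z = trans (3·≡ΣG z) (trans (sym (3·≡ΣG 𝟘)) (·-𝟘 3))
          where
            3·≡ΣG : ∀ z → 3 · z ≡ ΣG
            3·≡ΣG z = decidable-stable ((3 · z) ≟ ΣG) (λ 3z≢ΣG → ∄ (z , 3z≢ΣG))
        trivial : ∀ z → z ≡ 𝟘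
        trivial z with ≤3∧≢3⇒≡1⊎≡2 (proj₁ exponent) (q-minimal 3 (s≤s z≤n) 3·≡𝟘) q≢3
        ... | inj₁ q≡1 = trans (sym (identityʳ z)) (subst (λ m → m · z ≡ 𝟘) q≡1 (q·x≡𝟘 z))
        ... | inj₂ q≡2 = trans (sym (identityʳ z))
                           (trans (cong (z ⊕_) (sym (subst (λ m → m · z ≡ 𝟘) q≡2 (q·x≡𝟘 z)))) (3·≡𝟘 z))

    ∃-order-4 : q % 4 ≡ 0 → ∃[ y ] (y ⊕ y ≢ 𝟘 × (y ⊕ y) ⊕ (y ⊕ y) ≡ 𝟘)
    ∃-order-4 q%4≡0 = witness (any? (λ x → ¬? (((d + d) · x) ≟ 𝟘)))
      where
        d : ℕ
        d = q / 4
        q≡ : q ≡ (d + d) + (d + d)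
        q≡ = trans (m≡m%n+[m/n]*n q 4) (trans (cong (_+ d * 4) q%4≡0) (four d))
          where
            four : ∀ d → 0 + d * 4 ≡ (d + d) + (d + d)
            four = solve-∀
        0<d+d : 0 < d + d
        0<d+d = n≢0⇒n>0 (λ d+d≡0 →
          contradiction (subst (0 <_) (trans q≡ (cong₂ _+_ d+d≡0 d+d≡0)) (proj₁ exponent)) λ ())
        witness : Dec (∃ λ x → (d + d) · x ≢ 𝟘) → ∃[ y ] (y ⊕ y ≢ 𝟘 × (y ⊕ y) ⊕ (y ⊕ y) ≡ 𝟘)
        witness (yes (x , 2d·x≢𝟘)) = d · x , (λ 2y≡𝟘 → 2d·x≢𝟘 (trans (·-+ d d x) 2y≡𝟘)) , (begin
          (d · x ⊕ d · x) ⊕ (d · x ⊕ d · x) ≡⟨ cong₂ _⊕_ (·-+ d d x) (·-+ d d x) ⟨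
          (d + d) · x ⊕ (d + d) · x         ≡⟨ ·-+ (d + d) (d + d) x ⟨
          ((d + d) + (d + d)) · x           ≡⟨ cong (_· x) q≡ ⟨
          q · x                             ≡⟨ q·x≡𝟘 x ⟩
          𝟘                                 ∎)
          where open ≡-Reasoning
        witness (no ∄) = contradiction
          (q-minimal (d + d) 0<d+d (λ x → decidable-stable (((d + d) · x) ≟ 𝟘) (λ ne → ∄ (x , ne))))
          (<⇒≱ (subst (d + d <_) (sym q≡) (m<m+n (d + d) 0<d+d)))

    [q%4]·ΣG≡ΣG⇒ΣG≡𝟘 : (q % 4) · ΣG ≡ ΣG → ΣG ≡ 𝟘
    [q%4]·ΣG≡ΣG⇒ΣG≡𝟘 [q%4]·ΣG≡ΣG = begin
      ΣG           ≡⟨ [q%4]·ΣG≡ΣG ⟨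
      (q % 4) · ΣG ≡⟨ ·-% 4 (4·x≡𝟘 (trans (cong₂ _⊕_ ΣG⊕ΣG≡𝟘 ΣG⊕ΣG≡𝟘) (identityˡ 𝟘))) q ⟨
      q · ΣG       ≡⟨ q·x≡𝟘 ΣG ⟩
      𝟘            ∎
      where open ≡-Reasoning

    ΣG-halvable : ¬ (l ≡ 2 × q % 4 ≡ 2) → ∃[ b ] b ⊕ b ≡ ΣG
    ΣG-halvable ¬exceptional with ΣG ≟ 𝟘
    ... | yes ΣG≡𝟘 = 𝟘 , trans (identityˡ 𝟘) (sym ΣG≡𝟘)
    ... | no  ΣG≢𝟘 with m%4-cases q
    ... | inj₂ (inj₁ q%4≡1) =
      contradiction ([q%4]·ΣG≡ΣG⇒ΣG≡𝟘 (subst (λ r → r · ΣG ≡ ΣG) (sym q%4≡1) (identityʳ ΣG))) ΣG≢𝟘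
    ... | inj₂ (inj₂ (inj₁ q%4≡2)) = contradiction (ΣG≢𝟘⇒l≡2 ΣG≢𝟘 , q%4≡2) ¬exceptional
    ... | inj₂ (inj₂ (inj₂ q%4≡3)) =
      contradiction ([q%4]·ΣG≡ΣG⇒ΣG≡𝟘 (subst (λ r → r · ΣG ≡ ΣG) (sym q%4≡3) 3·ΣG≡ΣG)) ΣG≢𝟘
    ... | inj₁ q%4≡0 with ∃-order-4 q%4≡0
    ... | y , 2y≢𝟘 , 4y≡𝟘 with ΣG≢𝟘⇒ΣG-only-involution ΣG≢𝟘 (∈L⁺ 4y≡𝟘)
    ... | inj₁ 2y≡𝟘  = contradiction 2y≡𝟘 2y≢𝟘
    ... | inj₂ 2y≡ΣG = y , 2y≡ΣG

    ¬ΣG-halvable : l ≡ 2 → q % 4 ≡ 2 → ∀ b → b ⊕ b ≢ ΣG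
    ¬ΣG-halvable l≡2 q%4≡2 b b⊕b≡ΣG = l≡2⇒ΣG≢𝟘 l≡2 (begin
      ΣG           ≡⟨ b⊕b≡ΣG ⟨
      b ⊕ b        ≡⟨ 2·x≡x⊕x b ⟨
      2 · b        ≡⟨ cong (_· b) q%4≡2 ⟨
      (q % 4) · b  ≡⟨ ·-% 4 (4·x≡𝟘 (trans (cong₂ _⊕_ b⊕b≡ΣG b⊕b≡ΣG) ΣG⊕ΣG≡𝟘)) q ⟨
      q · b        ≡⟨ q·x≡𝟘 b ⟩
      𝟘            ∎)
      where open ≡-Reasoning

    Z≡suc : ∀ {h k} → 2 ≤ n → 1 ≤ k → suc h + k ≡ n → n + l ≤ 2 * h + 2 →
            (k ≡ 1 → ¬ (l ≡ 2 × q % 4 ≡ 2)) → (k ≡ 2 → q ≢ 3) → Z≡ G h (suc h)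
    Z≡suc {h} {k} 2≤n 1≤k n≡ n+l≤ k≡1⇒regular k≡2⇒q≢3 = Z≡suc-of-absorbing n≡ n+l≤
      (absorbing k 1≤k (n+l≤2h+2⇒l+[k+k]≤n {h} {k} n≡ n+l≤)
                 (ΣG-halvable ∘ k≡1⇒regular) (λ k≡2 → ∃-triple≢ΣG (k≡2⇒q≢3 k≡2) 2≤n))

    Z≡-of-q≡3 : ∀ {h} → 1 ≤ h → suc h + 2 ≡ n → n + l ≤ 2 * h + 2 → q ≡ 3 → Z≡ G h h
    Z≡-of-q≡3 1≤h n≡ n+l≤ q≡3 =
      Z≡-of-¬absorbing 1≤h n≡ n+l≤ (¬absorbing-2 (λ x → subst (λ m → m · x ≡ 𝟘) q≡3 (q·x≡𝟘 x)))

    Z≡-of-l≡2 : ∀ {h} → 1 ≤ h → suc h + 1 ≡ n → n + l ≤ 2 * h + 2 → l ≡ 2 → q % 4 ≡ 2 → Z≡ G h h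
    Z≡-of-l≡2 1≤h n≡ n+l≤ l≡2 q%4≡2 =
      Z≡-of-¬absorbing 1≤h n≡ n+l≤ (¬absorbing-1 (¬ΣG-halvable l≡2 q%4≡2))

theorem1p2 : (n : ℕ) → (G : FinAbGroup n) → 2 ≤ n → (q : ℕ) → FinAbGroup.IsExponent G q →
    (h : ℕ) → n + FinAbGroup.l G ≤ 2 * h + 2 → h + 2 ≤ n →
      C≡ G h (h + 1)
      × (((h + 3 ≡ n × q ≡ 3) ⊎ (h + 2 ≡ n × FinAbGroup.l G ≡ 2 × q % 4 ≡ 2)) → Z≡ G h h)
      × (¬ ((h + 3 ≡ n × q ≡ 3) ⊎ (h + 2 ≡ n × FinAbGroup.l G ≡ 2 × q % 4 ≡ 2)) → Z≡ G h (h + 1))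
theorem1p2 n G 2≤n q exponent h n+l≤ h+2≤n =
  subst (C≡ G h) h+1≡ (C≡suc suc-h<n n+l≤) ,
  [ (λ (h+3≡n , q≡3) → Z≡-of-q≡3 1≤h (suc-h+j≡n h+3≡n) n+l≤ q≡3)
  , (λ (h+2≡n , l≡2 , q%4≡2) → Z≡-of-l≡2 1≤h (suc-h+j≡n h+2≡n) n+l≤ l≡2 q%4≡2) ]′ ,
  λ regular → subst (Z≡ G h) h+1≡ (Z≡suc 2≤n (m<n⇒0<n∸m suc-h<n) n≡ n+l≤
    (λ k≡1 (l≡2 , q%4≡2) → regular (inj₂ (h+suc≡n k≡1 , l≡2 , q%4≡2)))
    (λ k≡2 q≡3 → regular (inj₁ (h+suc≡n k≡2 , q≡3))))
  where
    open FinAbGroupProperties G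
    open WithExponent exponent

    h+1≡ : suc h ≡ h + 1
    h+1≡ = +-comm 1 h
    suc-h<n : suc h < n
    suc-h<n = subst (_≤ n) (+-comm h 2) h+2≤n
    n≡ : suc h + (n ∸ suc h) ≡ n
    n≡ = m+[n∸m]≡n (<⇒≤ suc-h<n)
    1≤h : 1 ≤ h
    1≤h = n+l≤2h+2⇒1≤h h+2≤n 0<l n+l≤
    suc-h+j≡n : ∀ {j} → h + suc j ≡ n → suc h + j ≡ n
    suc-h+j≡n {j} = trans (sym (+-suc h j))
    h+suc≡n : ∀ {j} → n ∸ suc h ≡ j → h + suc j ≡ n
    h+suc≡n {j} n∸suc-h≡j = trans (+-suc h j) (trans (cong (suc h +_) (sym n∸suc-h≡j)) n≡)
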